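{- Fix a finite set $\mathcal{P}$ of predicate symbols and a finite set $\mathcal{C}$ of constant symbols, and let $k$ be a natural number. Then there are only finitely many equivalence classes (up to logical equivalence) of conjunctive set formulas of atoms built from $\mathcal{P}$, $\mathcal{C}$ and variables whose connected cardinality is at most $k$.
   Context: All formulas are function-free first-order formulas. A conjunctive set formula (CSF) of atoms is a finite set $\{a_1,\ldots,a_n\}$ of atoms $a_i=p(t_1,\ldots,t_m)$ (with $p\in\mathcal{P}$ and each term $t_j$ a constant of $\mathcal{C}$ or a variable), interpreted as the conjunction $a_1\wedge\cdots\wedge a_n$ with all its variables existentially quantified. For a CSF $F$, $\mathrm{vars}(F)$ is its set of variables and $\mathrm{card}(F)=|\mathrm{vars}(F)|$. Two variables $u,v$ of $F$ are connected if some atom of $F$ contains both, or (transitively) if there is a variable $z$ of $F$ connected to both. A CSF is connected if all its atoms contain variables and all its variables are connected to each other; an atom containing only constants is also regarded as a connected formula by itself. Every CSF $F$ is partitioned into its connected components $U_1,\ldots,U_n$ (connected CSFs such that variables in different $U_i$ are never connected), and $F$ is the conjunction of them. The connected cardinality of $F$ is $\max_i \mathrm{card}(U_i)$. -}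

module Defs where

open import Data.Nat using (ℕ; _≤_)
open import Data.Fin using (Fin)
open import Data.Vec using (Vec; toList) renaming (map to vmap)
open import Data.List using (List; length)
open import Data.List.Membership.Propositional using (_∈_)
open import Data.List.Relation.Unary.All using (All)
open import Data.Product using (Σ; ∃; _×_)

data Term (nc : ℕ) : Set where
  con : Fin nc → Term nc
  var : ℕ → Term nc

record Atom (np nc : ℕ) (arity : Fin np → ℕ) : Set where
  constructor atom
  field
    pred : Fin np
    args : Vec (Term nc) (arity pred)
open Atom public

-- A conjunctive set formula: a finite set of atoms, represented as a list
-- (order and repetitions are irrelevant to the semantics below).
CSF : (np nc : ℕ) → (Fin np → ℕ) → Set
CSF np nc arity = List (Atom np nc arity)

_occursIn_ : ∀ {np nc arity} → ℕ → Atom np nc arity → Set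
v occursIn a = var v ∈ toList (args a)

data Connected {np nc arity} (F : CSF np nc arity) : ℕ → ℕ → Set where
  direct : ∀ {a u v} → a ∈ F → u occursIn a → v occursIn a → Connected F u v
  trans  : ∀ {u z v} → Connected F u z → Connected F z v → Connected F u v

_isVarOf_ : ∀ {np nc arity} → ℕ → CSF np nc arity → Set
v isVarOf F = ∃ λ a → a ∈ F × v occursIn a

-- Connected cardinality of F is at most k: every connected component
-- (the set of variables connected to a given variable v of F) has at most
-- k elements, i.e. is covered by a list of length ≤ k.
ConnCard≤ : ∀ {np nc arity} → CSF np nc arity → ℕ → Set
ConnCard≤ F k = ∀ v → v isVarOf F →
  Σ (List ℕ) λ xs → length xs ≤ k × (∀ u → Connected F v u → u ∈ xs)

-- First-order structures (non-empty domain) for the signature.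
record Structure (np nc : ℕ) (arity : Fin np → ℕ) : Set₁ where
  field
    Dom  : Set
    elem : Dom
    cst  : Fin nc → Dom
    rel  : (p : Fin np) → Vec Dom (arity p) → Set
open Structure public

evalTerm : ∀ {np nc arity} (M : Structure np nc arity) → (ℕ → Dom M) → Term nc → Dom M
evalTerm M σ (con c) = cst M c
evalTerm M σ (var x) = σ x

_⊨_ : ∀ {np nc arity} → Structure np nc arity → CSF np nc arity → Set
M ⊨ F = Σ (ℕ → Dom M) λ σ → All (λ a → rel M (pred a) (vmap (evalTerm M σ) (args a))) F

_≋_ : ∀ {np nc arity} → CSF np nc arity → CSF np nc arity → Set₁
_≋_ {np} {nc} {arity} F G = (M : Structure np nc arity) → (M ⊨ F → M ⊨ G) × (M ⊨ G → M ⊨ F)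

module Submission where

-- Renaming each connected component of F onto the positions of its variables in a canonical
-- listing (of length at most k) turns the atoms of that component, together with the ground
-- atoms, into a "shape": a subset of the finite set of atoms over the variables 0, ..., k - 1.
-- F is equivalent to the conjunction of its distinct shapes, each copied onto its own block of
-- fresh variables: distinct components share no variables, so an assignment can be transported
-- component by component in both directions.  There are only finitely many sets of shapes, and
-- such a block conjunction has connected cardinality at most k, as connections never leave a block.

open import Defs
open import Data.Bool using (true; false)
open import Data.Nat using (ℕ; zero; suc; _+_; _*_; _≤_; _<_; z≤n; s≤s; NonZero; _/_; _%_)
open import Data.Nat.Properties
  using (_≟_; ≤-trans; m≤n⇒m≤1+n; ≤-reflexive; <⇒≤; <-≤-trans; <⇒≱;
         +-cancelˡ-≡; *-cancelʳ-≡)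
open import Data.Nat.DivMod using (m≡m%n+[m/n]*n; [m+kn]%n≡m%n; m<n⇒m%n≡m)
open import Data.Fin using (Fin)
import Data.Fin.Properties as Fin
open import Data.Vec using (Vec; []; _∷_; toList) renaming (map to vmap)
import Data.Vec.Properties as Vec
open import Data.List
  using (List; []; _∷_; [_]; _++_; length; map; concatMap; filter; deduplicate; upTo; allFin)
open import Data.List.Properties
  using (length-filter; filter-some; filter-≐; length-map; length-upTo; length-++-sucʳ)
import Data.List.Properties as List
open import Data.List.Membership.Propositional using (_∈_; _∉_; find; lose)
open import Data.List.Membership.Propositional.Properties
open import Data.List.Membership.DecPropositional _≟_ using (_∈?_)
open import Data.List.Relation.Binary.Subset.Propositional using (_⊆_)
open import Data.List.Relation.Unary.Any using (Any; here; there; any?)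
open import Data.List.Relation.Unary.All using (All; all?)
import Data.List.Relation.Unary.All as All
open import Data.List.Relation.Unary.All.Properties using (¬All⇒Any¬)
open import Data.List.Relation.Unary.AllPairs using (_∷_)
open import Data.List.Relation.Unary.Unique.Propositional using (Unique)
open import Data.List.Relation.Unary.Unique.Propositional.Properties using (filter⁺)
open import Data.List.Relation.Unary.Unique.DecPropositional.Properties using (deduplicate-!)
open import Data.Product using (Σ; ∃; ∃₂; _×_; _,_; proj₁; proj₂)
open import Data.Sum using (_⊎_; inj₁; inj₂)
open import Data.Empty using (⊥-elim)
open import Function using (_∘_; case_of_)
open import Level using (0ℓ)
open import Relation.Binary.Definitions using (DecidableEquality)
open import Relation.Binary.PropositionalEquality
  using (_≡_; _≢_; refl; sym; cong; subst; module ≡-Reasoning)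
import Relation.Binary.PropositionalEquality as ≡
open import Relation.Nullary using (Dec; yes; no; does)
open import Relation.Unary using (Pred; Decidable)

module _ {A : Set} where

  sublists : List A → List (List A)
  sublists []       = [ [] ]
  sublists (x ∷ xs) = map (x ∷_) (sublists xs) ++ sublists xs

  filter∈sublists : {P : Pred A 0ℓ} (P? : Decidable P) (xs : List A) →
                    filter P? xs ∈ sublists xs
  filter∈sublists P? []       = here refl
  filter∈sublists P? (x ∷ xs) with does (P? x)
  ... | true  = ∈-++⁺ˡ (∈-map⁺ (x ∷_) (filter∈sublists P? xs))
  ... | false = ∈-++⁺ʳ _ (filter∈sublists P? xs)

  sublists-⊆ : ∀ {ys} xs → ys ∈ sublists xs → ys ⊆ xs
  sublists-⊆ []       (here refl) ()
  sublists-⊆ (x ∷ xs) ys∈ y∈ with ∈-++⁻ (map (x ∷_) (sublists xs)) ys∈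
  ... | inj₂ zs∈ = there (sublists-⊆ xs zs∈ y∈)
  ... | inj₁ x∷zs∈ with ∈-map⁻ (x ∷_) x∷zs∈ | y∈
  ...   | _ , _    , refl | here refl = here refl
  ...   | _ , zs∈ , refl | there y∈zs = there (sublists-⊆ xs zs∈ y∈zs)

  vectors : (n : ℕ) → List A → List (Vec A n)
  vectors zero    xs = [ [] ]
  vectors (suc n) xs = concatMap (λ x → map (x ∷_) (vectors n xs)) xs

  ∈-vectors⁺ : ∀ {n} {xs} (v : Vec A n) → toList v ⊆ xs → v ∈ vectors n xs
  ∈-vectors⁺ []      _   = here refl
  ∈-vectors⁺ (x ∷ v) v⊆ =
    ∈-concatMap⁺ _ (lose (v⊆ (here refl)) (∈-map⁺ (x ∷_) (∈-vectors⁺ v (v⊆ ∘ there))))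

  ∈-vectors⁻ : ∀ n {xs} {v : Vec A n} → v ∈ vectors n xs → toList v ⊆ xs
  ∈-vectors⁻ zero    (here refl) ()
  ∈-vectors⁻ (suc n) {xs} v∈ t∈
    with find (∈-concatMap⁻ (λ x → map (x ∷_) (vectors n xs)) {xs} v∈)
  ... | x , x∈ , x∷w∈ with ∈-map⁻ (x ∷_) x∷w∈ | t∈
  ...   | _ , _   , refl | here refl = x∈
  ...   | _ , w∈ , refl | there t∈w = ∈-vectors⁻ n w∈ t∈w

  nthOr : A → List A → ℕ → A
  nthOr d []       _       = d
  nthOr d (x ∷ xs) zero    = x
  nthOr d (x ∷ xs) (suc i) = nthOr d xs i

  module _ (_≟ᴬ_ : DecidableEquality A) where

    indexOf : A → List A → ℕ
    indexOf y []       = 0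
    indexOf y (x ∷ xs) with y ≟ᴬ x
    ... | yes _ = 0
    ... | no  _ = suc (indexOf y xs)

    indexOf-< : ∀ {y xs} → y ∈ xs → indexOf y xs < length xs
    indexOf-< {y} {x ∷ xs} y∈ with y ≟ᴬ x | y∈
    ... | yes _   | _          = s≤s z≤n
    ... | no  y≢x | here y≡x   = ⊥-elim (y≢x y≡x)
    ... | no  _   | there y∈xs = s≤s (indexOf-< y∈xs)

    nthOr-indexOf : ∀ d {y xs} → y ∈ xs → nthOr d xs (indexOf y xs) ≡ y
    nthOr-indexOf d {y} {x ∷ xs} y∈ with y ≟ᴬ x | y∈
    ... | yes y≡x | _          = sym y≡x
    ... | no  y≢x | here y≡x   = ⊥-elim (y≢x y≡x)
    ... | no  _   | there y∈xs = nthOr-indexOf d y∈xs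

  unique-⊆⇒length≤ : ∀ {xs ys : List A} → Unique xs → xs ⊆ ys → length xs ≤ length ys
  unique-⊆⇒length≤ {[]}     _               _   = z≤n
  unique-⊆⇒length≤ {x ∷ xs} (x∉xs ∷ !xs) x∷xs⊆ys
    with pre , post , refl ← ∈-∃++ (x∷xs⊆ys (here refl)) =
    subst (suc (length xs) ≤_) (sym (length-++-sucʳ pre x post))
      (s≤s (unique-⊆⇒length≤ !xs xs⊆pre++post))
    where
      xs⊆pre++post : xs ⊆ pre ++ post
      xs⊆pre++post {z} z∈xs with ∈-++⁻ pre (x∷xs⊆ys (there z∈xs))
      ... | inj₁ z∈pre           = ∈-++⁺ˡ z∈pre
      ... | inj₂ (here refl)     = ⊥-elim (All.lookup x∉xs z∈xs refl)
      ... | inj₂ (there z∈post)  = ∈-++⁺ʳ pre z∈post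

module _ (n : ℕ) .{{_ : NonZero n}} {i : ℕ} (j : ℕ) (i<n : i < n) where

  [i+jn]%n≡i : (i + j * n) % n ≡ i
  [i+jn]%n≡i = ≡.trans ([m+kn]%n≡m%n i j n) (m<n⇒m%n≡m i<n)

  [i+jn]/n≡j : (i + j * n) / n ≡ j
  [i+jn]/n≡j = sym (*-cancelʳ-≡ j _ n (+-cancelˡ-≡ i _ _ (begin
    i + j * n                                    ≡⟨ m≡m%n+[m/n]*n (i + j * n) n ⟩
    (i + j * n) % n + (i + j * n) / n * n        ≡⟨ cong (_+ (i + j * n) / n * n) [i+jn]%n≡i ⟩
    i + (i + j * n) / n * n                      ∎)))
    where open ≡-Reasoning

module _ {nc : ℕ} where

  termVars : List (Term nc) → List ℕ
  termVars []           = []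
  termVars (con _ ∷ ts) = termVars ts
  termVars (var v ∷ ts) = v ∷ termVars ts

  ∈-termVars⁺ : ∀ {v} ts → var v ∈ ts → v ∈ termVars ts
  ∈-termVars⁺ (con _ ∷ ts) (there v∈) = ∈-termVars⁺ ts v∈
  ∈-termVars⁺ (var _ ∷ ts) (here refl) = here refl
  ∈-termVars⁺ (var _ ∷ ts) (there v∈) = there (∈-termVars⁺ ts v∈)

  ∈-termVars⁻ : ∀ {v} ts → v ∈ termVars ts → var v ∈ ts
  ∈-termVars⁻ (con _ ∷ ts) v∈          = there (∈-termVars⁻ ts v∈)
  ∈-termVars⁻ (var _ ∷ ts) (here refl) = here refl
  ∈-termVars⁻ (var _ ∷ ts) (there v∈)  = there (∈-termVars⁻ ts v∈)

  renameTerm : (ℕ → ℕ) → Term nc → Term nc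
  renameTerm f (con c) = con c
  renameTerm f (var v) = var (f v)

  _≟ᵗ_ : DecidableEquality (Term nc)
  con c ≟ᵗ con d with c Fin.≟ d
  ... | yes refl = yes refl
  ... | no  c≢d  = no λ { refl → c≢d refl }
  con _ ≟ᵗ var _ = no λ ()
  var _ ≟ᵗ con _ = no λ ()
  var v ≟ᵗ var w with v ≟ w
  ... | yes refl = yes refl
  ... | no  v≢w  = no λ { refl → v≢w refl }

module _ {np nc : ℕ} {arity : Fin np → ℕ} where

  vars : Atom np nc arity → List ℕ
  vars a = termVars (toList (args a))

  occurs⇒∈vars : ∀ {v} a → v occursIn a → v ∈ vars a
  occurs⇒∈vars a = ∈-termVars⁺ (toList (args a))

  ∈vars⇒occurs : ∀ {v} a → v ∈ vars a → v occursIn a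
  ∈vars⇒occurs a = ∈-termVars⁻ (toList (args a))

  rename : (ℕ → ℕ) → Atom np nc arity → Atom np nc arity
  rename f a = atom (pred a) (vmap (renameTerm f) (args a))

  ∈-vars-rename⁻ : ∀ f a {y} → y ∈ vars (rename f a) → ∃ λ z → z ∈ vars a × y ≡ f z
  ∈-vars-rename⁻ f a y∈ with ∈-map⁻ (renameTerm f)
         (subst (_ ∈_) (Vec.toList-map (renameTerm f) (args a)) (∈vars⇒occurs (rename f a) y∈))
  ... | var z , z∈ , refl = z , occurs⇒∈vars a z∈ , refl

  _≟ᵃ_ : DecidableEquality (Atom np nc arity)
  atom p xs ≟ᵃ atom q ys with p Fin.≟ q
  ... | no  p≢q  = no λ { refl → p≢q refl }
  ... | yes refl with Vec.≡-dec _≟ᵗ_ xs ys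
  ...   | yes refl  = yes refl
  ...   | no  xs≢ys = no λ { refl → xs≢ys refl }

  Holds : (M : Structure np nc arity) → (ℕ → Dom M) → Atom np nc arity → Set
  Holds M σ a = rel M (pred a) (vmap (evalTerm M σ) (args a))

  module _ (M : Structure np nc arity) {σ σ′ : ℕ → Dom M} (f : ℕ → ℕ) where

    eval-renameTerms : ∀ {n} (ts : Vec (Term nc) n) →
      (∀ {y} → y ∈ termVars (toList ts) → σ′ (f y) ≡ σ y) →
      vmap (evalTerm M σ′) (vmap (renameTerm f) ts) ≡ vmap (evalTerm M σ) ts
    eval-renameTerms []           _     = refl
    eval-renameTerms (con c ∷ ts) agree = cong (cst M c ∷_) (eval-renameTerms ts agree)
    eval-renameTerms (var v ∷ ts) agree =
      ≡.cong₂ _∷_ (agree (here refl)) (eval-renameTerms ts (agree ∘ there))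

    module _ {a : Atom np nc arity} (agree : ∀ {y} → y ∈ vars a → σ′ (f y) ≡ σ y) where

      holds-rename⁺ : Holds M σ a → Holds M σ′ (rename f a)
      holds-rename⁺ = subst (rel M (pred a)) (sym (eval-renameTerms (args a) agree))

      holds-rename⁻ : Holds M σ′ (rename f a) → Holds M σ a
      holds-rename⁻ = subst (rel M (pred a)) (eval-renameTerms (args a) agree)

  termsBelow : ℕ → List (Term nc)
  termsBelow k = map con (allFin nc) ++ map var (upTo k)

  atomsBelow : ℕ → List (Atom np nc arity)
  atomsBelow k = concatMap (λ p → map (atom p) (vectors (arity p) (termsBelow k))) (allFin np)

  ∈-atomsBelow⁺ : ∀ {k} b → (∀ {y} → y ∈ vars b → y < k) → b ∈ atomsBelow k
  ∈-atomsBelow⁺ {k} (atom p ts) vars<k =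
    ∈-concatMap⁺ _ (lose (∈-allFin p) (∈-map⁺ (atom p) (∈-vectors⁺ ts ts⊆)))
    where
      ts⊆ : toList ts ⊆ termsBelow k
      ts⊆ {con c} _  = ∈-++⁺ˡ (∈-map⁺ con (∈-allFin c))
      ts⊆ {var y} y∈ =
        ∈-++⁺ʳ _ (∈-map⁺ var (∈-upTo⁺ (vars<k (∈-termVars⁺ (toList ts) y∈))))

  ∈-atomsBelow⁻ : ∀ {k b y} → b ∈ atomsBelow k → y ∈ vars b → y < k
  ∈-atomsBelow⁻ {k} {b} b∈ y∈ with find (∈-concatMap⁻ _ {allFin np} b∈)
  ... | p , _ , b∈p with ∈-map⁻ (atom p) b∈p
  ... | ts , ts∈ , refl
    with ∈-++⁻ (map con (allFin nc)) (∈-vectors⁻ (arity p) ts∈ (∈vars⇒occurs b y∈))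
  ... | inj₁ y∈cons with ∈-map⁻ con y∈cons
  ...   | _ , _ , ()
  ∈-atomsBelow⁻ b∈ y∈ | _ | _ | inj₂ y∈vars with ∈-map⁻ var y∈vars
  ...   | _ , y<k , refl = ∈-upTo⁻ y<k

module Components {np nc : ℕ} {arity : Fin np → ℕ} (F : CSF np nc arity) where

  connected-sym : ∀ {u v} → Connected F u v → Connected F v u
  connected-sym (direct a∈ u∈ v∈) = direct a∈ v∈ u∈
  connected-sym (trans c d)       = trans (connected-sym d) (connected-sym c)

  connected-refl : ∀ {v} → v isVarOf F → Connected F v v
  connected-refl (_ , a∈ , v∈) = direct a∈ v∈ v∈

  connected⇒isVar : ∀ {u v} → Connected F u v → v isVarOf F
  connected⇒isVar (direct a∈ _ v∈) = _ , a∈ , v∈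
  connected⇒isVar (trans _ d)      = connected⇒isVar d

  varList : List ℕ
  varList = deduplicate _≟_ (concatMap vars F)

  isVar⇒∈varList : ∀ {v} → v isVarOf F → v ∈ varList
  isVar⇒∈varList (a , a∈ , v∈) =
    ∈-deduplicate⁺ _≟_ (∈-concatMap⁺ vars (lose a∈ (occurs⇒∈vars a v∈)))

  Meets : List ℕ → Atom np nc arity → Set
  Meets R a = Any (_∈ R) (vars a)

  meets? : ∀ R → Decidable (Meets R)
  meets? R a = any? (_∈? R) (vars a)

  expand : List ℕ → List ℕ
  expand R = R ++ concatMap vars (filter (meets? R) F)

  ∈-expand⁺ : ∀ R {a u} → a ∈ F → Meets R a → u ∈ vars a → u ∈ expand R
  ∈-expand⁺ R a∈ meets u∈ =
    ∈-++⁺ʳ R (∈-concatMap⁺ vars (lose (∈-filter⁺ (meets? R) a∈ meets) u∈))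

  ∈-expand⁻ : ∀ R {u} → u ∈ expand R →
              u ∈ R ⊎ ∃ λ a → a ∈ F × Meets R a × u ∈ vars a
  ∈-expand⁻ R u∈ with ∈-++⁻ R u∈
  ... | inj₁ u∈R = inj₁ u∈R
  ... | inj₂ u∈new with find (∈-concatMap⁻ vars u∈new)
  ...   | a , a∈ , u∈a with ∈-filter⁻ (meets? R) a∈
  ...     | a∈F , meets = inj₂ (a , a∈F , meets , u∈a)

  reach : ℕ → ℕ → List ℕ
  reach zero    x = [ x ]
  reach (suc n) x = expand (reach n x)

  reach-sound : ∀ {x} → x isVarOf F → ∀ n {u} → u ∈ reach n x → Connected F x u
  reach-sound x-var zero    (here refl) = connected-refl x-var
  reach-sound {x} x-var (suc n) u∈ with ∈-expand⁻ (reach n x) u∈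
  ... | inj₁ u∈R = reach-sound x-var n u∈R
  ... | inj₂ (a , a∈ , meets , u∈a) with find meets
  ...   | w , w∈a , w∈R =
    trans (reach-sound x-var n w∈R) (direct a∈ (∈vars⇒occurs a w∈a) (∈vars⇒occurs a u∈a))

  Closed : List ℕ → Set
  Closed R = expand R ⊆ R

  closed-expand : ∀ {R} → Closed R → Closed (expand R)
  closed-expand {R} closed u∈ with ∈-expand⁻ (expand R) u∈
  ... | inj₁ u∈ER = ∈-++⁺ˡ (closed u∈ER)
  ... | inj₂ (a , a∈ , meets , u∈a) with find meets
  ...   | w , w∈a , w∈ER = ∈-expand⁺ R a∈ (lose w∈a (closed w∈ER)) u∈a

  closed-connected : ∀ {R w u} → Closed R → w ∈ R → Connected F w u → u ∈ R
  closed-connected {R} closed w∈ (direct {a} a∈ w∈a u∈a) =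
    closed (∈-expand⁺ R a∈ (lose (occurs⇒∈vars a w∈a) w∈) (occurs⇒∈vars a u∈a))
  closed-connected closed w∈ (trans c d) = closed-connected closed (closed-connected closed w∈ c) d

  varsIn : List ℕ → List ℕ
  varsIn R = filter (_∈? R) varList

  varsIn-expand-grows : ∀ R {u} → u ∈ varList → u ∈ expand R → u ∉ R →
                        suc (length (varsIn R)) ≤ length (varsIn (expand R))
  varsIn-expand-grows R {u} u∈V u∈ER u∉R =
    unique-⊆⇒length≤ (All.tabulate u≢ ∷ filter⁺ (_∈? R) (deduplicate-! _≟_ (concatMap vars F)))
                     ⊆varsIn
    where
      u≢ : ∀ {z} → z ∈ varsIn R → u ≢ z
      u≢ z∈ refl = u∉R (proj₂ (∈-filter⁻ (_∈? R) {xs = varList} z∈))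
      ⊆varsIn : u ∷ varsIn R ⊆ varsIn (expand R)
      ⊆varsIn (here refl) = ∈-filter⁺ (_∈? expand R) u∈V u∈ER
      ⊆varsIn (there z∈) with ∈-filter⁻ (_∈? R) {xs = varList} z∈
      ... | z∈V , z∈R = ∈-filter⁺ (_∈? expand R) z∈V (∈-++⁺ˡ z∈R)

  -- A round of `expand` that is not a fixed point adds a new variable of F (pigeonhole on
  -- `varList`), so `length varList` rounds reach a fixed point.
  reach-closes-or-grows : ∀ {x} → x isVarOf F → ∀ n →
                          Closed (reach n x) ⊎ n < length (varsIn (reach n x))
  reach-closes-or-grows x-var zero =
    inj₂ (filter-some (_∈? [ _ ]) (lose (isVar⇒∈varList x-var) (here refl)))
  reach-closes-or-grows {x} x-var (suc n) with reach-closes-or-grows x-var n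
  ... | inj₁ closed = inj₁ (closed-expand closed)
  ... | inj₂ grown with all? (_∈? reach n x) (expand (reach n x))
  ...   | yes all∈ = inj₁ (closed-expand (All.lookup all∈))
  ...   | no ¬all∈ with find (¬All⇒Any¬ (_∈? reach n x) (expand (reach n x)) ¬all∈)
  ...     | u , u∈ER , u∉R = inj₂ (<-≤-trans (s≤s grown)
              (varsIn-expand-grows (reach n x) u∈V u∈ER u∉R))
    where
      u∈V : u ∈ varList
      u∈V with ∈-expand⁻ (reach n x) u∈ER
      ... | inj₁ u∈R                = ⊥-elim (u∉R u∈R)
      ... | inj₂ (a , a∈ , _ , u∈a) = isVar⇒∈varList (a , a∈ , ∈vars⇒occurs a u∈a)

  reach-closed : ∀ {x} → x isVarOf F → Closed (reach (length varList) x)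
  reach-closed {x} x-var with reach-closes-or-grows x-var (length varList)
  ... | inj₁ closed = closed
  ... | inj₂ grown  = ⊥-elim (<⇒≱ grown (length-filter (_∈? reach (length varList) x) varList))

  reach-complete : ∀ {x u} → x isVarOf F → Connected F x u → u ∈ reach (length varList) x
  reach-complete x-var = closed-connected (reach-closed x-var) (start (length varList))
    where
      start : ∀ n → _ ∈ reach n _
      start zero    = here refl
      start (suc n) = ∈-++⁺ˡ (start n)

  component : ℕ → List ℕ
  component x = varsIn (reach (length varList) x)

  ∈-component⁺ : ∀ {x u} → x isVarOf F → Connected F x u → u ∈ component x
  ∈-component⁺ x-var c =
    ∈-filter⁺ (_∈? _) (isVar⇒∈varList (connected⇒isVar c)) (reach-complete x-var c)

  component-unique : ∀ x → Unique (component x)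
  component-unique x = filter⁺ (_∈? _) (deduplicate-! _≟_ (concatMap vars F))

  component-cong : ∀ {x y} → Connected F x y → component x ≡ component y
  component-cong {x} {y} c =
    filter-≐ (_∈? reach N x) (_∈? reach N y) (reach-moves c , reach-moves (connected-sym c)) varList
    where
      N = length varList
      reach-moves : ∀ {x y u} → Connected F x y → u ∈ reach N x → u ∈ reach N y
      reach-moves c u∈ = reach-complete (connected⇒isVar c)
        (trans (connected-sym c) (reach-sound (connected⇒isVar (connected-sym c)) N u∈))

  ∈-component⁻ : ∀ {x u} → x isVarOf F → u ∈ component x → Connected F x u
  ∈-component⁻ x-var u∈ =
    reach-sound x-var (length varList) (proj₂ (∈-filter⁻ (_∈? _) {xs = varList} u∈))

  component-length≤ : ∀ {k x} → ConnCard≤ F k → x isVarOf F → length (component x) ≤ k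
  component-length≤ {x = x} connCard x-var with connCard x x-var
  ... | cover , cover≤k , covers = ≤-trans
    (unique-⊆⇒length≤ (component-unique x) (covers _ ∘ ∈-component⁻ x-var)) cover≤k

module Blocks {np nc : ℕ} {arity : Fin np → ℕ} (k : ℕ) where

  -- Block j holds the variables i + j * (k + 1) with i < k; the width is k + 1 rather than k
  -- only to keep the divisor non-zero when k = 0.
  shift : ℕ → ℕ → ℕ
  shift j i = i + j * suc k

  InBlock : ℕ → ℕ → Set
  InBlock j v = ∃ λ i → i < k × v ≡ shift j i

  inBlock-unique : ∀ {j j′ v} → InBlock j v → InBlock j′ v → j ≡ j′
  inBlock-unique {j} {j′} (i , i<k , refl) (i′ , i′<k , v≡) = begin
    j                          ≡⟨ sym ([i+jn]/n≡j (suc k) j (s≤s (<⇒≤ i<k))) ⟩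
    shift j i / suc k          ≡⟨ cong (_/ suc k) v≡ ⟩
    shift j′ i′ / suc k        ≡⟨ [i+jn]/n≡j (suc k) j′ (s≤s (<⇒≤ i′<k)) ⟩
    j′                         ∎
    where open ≡-Reasoning

  module _ (G : CSF np nc arity)
           (blocked : ∀ {b} → b ∈ G → ∃ λ j → ∀ {y} → y ∈ vars b → InBlock j y) where

    connected-inBlock : ∀ {u v} → Connected G u v → ∃ λ j → InBlock j u × InBlock j v
    connected-inBlock (direct {a} a∈ u∈ v∈) with blocked a∈
    ... | j , inBlock = j , inBlock (occurs⇒∈vars a u∈) , inBlock (occurs⇒∈vars a v∈)
    connected-inBlock (trans c d) with connected-inBlock c | connected-inBlock d
    ... | j , u∈j , z∈j | j′ , z∈j′ , v∈j′
      with refl ← inBlock-unique {j} {j′} z∈j z∈j′ = j , u∈j , v∈j′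

    connCard-blocked : ConnCard≤ G k
    connCard-blocked v (a , a∈ , v∈a) with blocked a∈
    ... | j , inBlock = map (shift j) (upTo k) , len≤k , covers
      where
        len≤k : length (map (shift j) (upTo k)) ≤ k
        len≤k = ≤-reflexive (≡.trans (length-map (shift j) (upTo k)) (length-upTo k))
        covers : ∀ u → Connected G v u → u ∈ map (shift j) (upTo k)
        covers u c with connected-inBlock c
        ... | j′ , v∈j′ , (i , i<k , refl)
          with refl ← inBlock-unique {j} {j′} (inBlock (occurs⇒∈vars a v∈a)) v∈j′ =
          ∈-map⁺ (shift j) (∈-upTo⁺ i<k)

  _≟ˢ_ : DecidableEquality (List (Atom np nc arity))
  _≟ˢ_ = List.≡-dec _≟ᵃ_

  shapes : List (List (Atom np nc arity))
  shapes = sublists (atomsBelow k)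

  position : List (Atom np nc arity) → ℕ
  position u = indexOf _≟ˢ_ u shapes

  assemble : List (List (Atom np nc arity)) → CSF np nc arity
  assemble T = concatMap (λ u → map (rename (shift (position u))) u) T

  ∈-assemble⁺ : ∀ {T u b} → u ∈ T → b ∈ u → rename (shift (position u)) b ∈ assemble T
  ∈-assemble⁺ {u = u} u∈ b∈ =
    ∈-concatMap⁺ _ (lose u∈ (∈-map⁺ (rename (shift (position u))) b∈))

  ∈-assemble⁻ : ∀ {T b} → b ∈ assemble T →
                ∃₂ λ u b′ → u ∈ T × b′ ∈ u × b ≡ rename (shift (position u)) b′
  ∈-assemble⁻ {T} b∈ with find (∈-concatMap⁻ _ {T} b∈)
  ... | u , u∈ , b∈u with ∈-map⁻ (rename (shift (position u))) b∈u
  ... | b′ , b′∈ , b≡ = u , b′ , u∈ , b′∈ , b≡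

  assemble-connCard : ∀ {T} → T ∈ sublists shapes → ConnCard≤ (assemble T) k
  assemble-connCard {T} T∈ = connCard-blocked (assemble T) blocked
    where
      blocked : ∀ {b} → b ∈ assemble T → ∃ λ j → ∀ {y} → y ∈ vars b → InBlock j y
      blocked b∈ with ∈-assemble⁻ b∈
      ... | u , b′ , u∈T , b′∈u , refl = position u , inBlock
        where
          b′∈below : b′ ∈ atomsBelow k
          b′∈below = sublists-⊆ (atomsBelow k) (sublists-⊆ shapes T∈ u∈T) b′∈u
          inBlock : ∀ {y} → y ∈ vars (rename (shift (position u)) b′) → InBlock (position u) y
          inBlock y∈ with ∈-vars-rename⁻ (shift (position u)) b′ y∈
          ... | z , z∈ , refl = z , ∈-atomsBelow⁻ b′∈below z∈ , refl

  representatives : List (CSF np nc arity)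
  representatives = map assemble (sublists shapes)

module Normalise {np nc : ℕ} {arity : Fin np → ℕ} (k : ℕ)
                 (F : CSF np nc arity) (connCard : ConnCard≤ F k) where
  open Components F
  open Blocks {np} {nc} {arity} k
  open import Data.List.Membership.DecPropositional (_≟ᵃ_ {np} {nc} {arity})
    using () renaming (_∈?_ to _∈ᵃ?_)
  open import Data.List.Membership.DecPropositional _≟ˢ_
    using () renaming (_∈?_ to _∈ˢ?_)

  componentOfVars : List ℕ → List ℕ
  componentOfVars []      = []
  componentOfVars (x ∷ _) = component x

  componentOf : Atom np nc arity → List ℕ
  componentOf a = componentOfVars (vars a)

  component≡componentOf : ∀ {a y} → a ∈ F → y ∈ vars a → component y ≡ componentOf a
  component≡componentOf {a} a∈ y∈ with vars a in eq | y∈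
  ... | x ∷ _ | y∈xs = component-cong (direct a∈ (occurs y∈xs) (occurs (here refl)))
    where
      occurs : ∀ {z} → z ∈ x ∷ _ → z occursIn a
      occurs z∈ = ∈vars⇒occurs a (subst (_ ∈_) (sym eq) z∈)

  ∈-componentOf : ∀ {a y} → a ∈ F → y ∈ vars a → y ∈ componentOf a
  ∈-componentOf {a} a∈ y∈ = subst (_ ∈_) (component≡componentOf a∈ y∈)
    (∈-component⁺ y-var (connected-refl y-var))
    where y-var = a , a∈ , ∈vars⇒occurs a y∈

  componentOf-length≤ : ∀ {a} → a ∈ F → length (componentOf a) ≤ k
  componentOf-length≤ {a} a∈ with vars a in eq
  ... | []    = z≤n
  ... | x ∷ _ =
    component-length≤ connCard (a , a∈ , ∈vars⇒occurs a (subst (_ ∈_) (sym eq) (here refl)))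

  localIndex : List ℕ → ℕ → ℕ
  localIndex K y = indexOf _≟_ y K

  within? : ∀ K (a : Atom np nc arity) → Dec (All (_∈ K) (vars a))
  within? K a = all? (_∈? K) (vars a)

  atomsWithin : List ℕ → CSF np nc arity
  atomsWithin K = filter (within? K) F

  shapeOf : List ℕ → List (Atom np nc arity)
  shapeOf K = filter (_∈ᵃ? map (rename (localIndex K)) (atomsWithin K)) (atomsBelow k)

  realized : List (List (Atom np nc arity))
  realized = map (shapeOf ∘ componentOf) F

  witness : List (Atom np nc arity) → List ℕ
  witness u with u ∈ˢ? realized
  ... | yes u∈ = componentOf (proj₁ (∈-map⁻ (shapeOf ∘ componentOf) u∈))
  ... | no  _  = []

  witness-spec : ∀ {u} → u ∈ realized → length (witness u) ≤ k × shapeOf (witness u) ≡ u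
  witness-spec {u} u∈ with u ∈ˢ? realized
  ... | no u∉ = ⊥-elim (u∉ u∈)
  ... | yes u∈′ with ∈-map⁻ (shapeOf ∘ componentOf) u∈′
  ...   | a , a∈ , refl = componentOf-length≤ a∈ , refl

  normalForm : CSF np nc arity
  normalForm = assemble (filter (_∈ˢ? realized) shapes)

  normalForm∈representatives : normalForm ∈ representatives
  normalForm∈representatives = ∈-map⁺ assemble (filter∈sublists (_∈ˢ? realized) shapes)

  module _ (M : Structure np nc arity) (σ : ℕ → Dom M) where

    -- Variable i + j * (k + 1) of the normal form stands for the i-th variable of a component
    -- whose shape is the j-th element of `shapes`.
    τ : ℕ → Dom M
    τ n = σ (nthOr 0 (witness (nthOr [] shapes (n / suc k))) (n % suc k))

    τ-shift : ∀ {u i} → u ∈ shapes → i < suc k →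
              τ (shift (position u) i) ≡ σ (nthOr 0 (witness u) i)
    τ-shift {u} {i} u∈ i<1+k = begin
      τ (shift (position u) i)
        ≡⟨ ≡.cong₂ (λ j i → σ (nthOr 0 (witness (nthOr [] shapes j)) i))
                   ([i+jn]/n≡j (suc k) (position u) i<1+k) ([i+jn]%n≡i (suc k) (position u) i<1+k) ⟩
      σ (nthOr 0 (witness (nthOr [] shapes (position u))) i)
        ≡⟨ cong (λ u → σ (nthOr 0 (witness u) i)) (nthOr-indexOf _≟ˢ_ [] u∈) ⟩
      σ (nthOr 0 (witness u) i)
        ∎
      where open ≡-Reasoning

    normalForm-holds : All (Holds M σ) F → All (Holds M τ) normalForm
    normalForm-holds sat = All.tabulate holds
      where
        holds : ∀ {b} → b ∈ normalForm → Holds M τ b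
        holds b∈ with ∈-assemble⁻ b∈
        ... | u , b′ , u∈T , b′∈u , refl
          with u∈shapes , u∈realized ← ∈-filter⁻ (_∈ˢ? realized) {xs = shapes} u∈T
          with K≤k , shape≡u ← witness-spec u∈realized
          with _ , b′∈local ←
                 ∈-filter⁻ (_∈ᵃ? _) {xs = atomsBelow k} (subst (b′ ∈_) (sym shape≡u) b′∈u)
          with a , a∈W , refl ← ∈-map⁻ (rename (localIndex (witness u))) b′∈local
          with a∈F , a⊆K ← ∈-filter⁻ (within? (witness u)) {xs = F} a∈W =
          holds-rename⁺ M (shift (position u)) (λ _ → refl)
            (holds-rename⁺ M (localIndex (witness u)) agree (All.lookup sat a∈F))
          where
            agree : ∀ {y} → y ∈ vars a → τ (shift (position u) (localIndex (witness u) y)) ≡ σ y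
            agree y∈ = ≡.trans
              (τ-shift u∈shapes (<-≤-trans (indexOf-< _≟_ y∈K) (m≤n⇒m≤1+n K≤k)))
              (cong σ (nthOr-indexOf _≟_ 0 y∈K))
              where y∈K = All.lookup a⊆K y∈

  module _ (M : Structure np nc arity) (τ : ℕ → Dom M) where

    σ : ℕ → Dom M
    σ y = τ (shift (position (shapeOf (component y))) (localIndex (component y) y))

    F-holds : All (Holds M τ) normalForm → All (Holds M σ) F
    F-holds sat = All.tabulate holds
      where
        holds : ∀ {a} → a ∈ F → Holds M σ a
        holds {a} a∈ =
          holds-rename⁻ M (localIndex K) agree
            (holds-rename⁻ M (shift (position u)) (λ _ → refl)
              (All.lookup sat (∈-assemble⁺ u∈T a′∈u)))
          where
            K = componentOf a
            u = shapeOf K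
            a′ = rename (localIndex K) a
            a′∈below : a′ ∈ atomsBelow k
            a′∈below = ∈-atomsBelow⁺ a′ λ y∈ → case ∈-vars-rename⁻ (localIndex K) a y∈ of λ
              { (z , z∈ , refl) →
                  <-≤-trans (indexOf-< _≟_ (∈-componentOf a∈ z∈)) (componentOf-length≤ a∈) }
            a′∈u : a′ ∈ u
            a′∈u = ∈-filter⁺ (_∈ᵃ? _) a′∈below
              (∈-map⁺ (rename (localIndex K))
                (∈-filter⁺ (within? K) a∈ (All.tabulate (∈-componentOf a∈))))
            u∈T : u ∈ filter (_∈ˢ? realized) shapes
            u∈T = ∈-filter⁺ (_∈ˢ? realized) (filter∈sublists (_∈ᵃ? _) (atomsBelow k))
                            (∈-map⁺ (shapeOf ∘ componentOf) a∈)
            agree : ∀ {y} → y ∈ vars a → τ (shift (position u) (localIndex K y)) ≡ σ y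
            agree {y} y∈ = cong (λ K → τ (shift (position (shapeOf K)) (localIndex K y)))
                            (sym (component≡componentOf a∈ y∈))

  equivalence : F ≋ normalForm
  equivalence M = (λ (σ , sat) → τ M σ , normalForm-holds M σ sat)
                , (λ (τ , sat) → σ M τ , F-holds M τ sat)

lemma2 : (np nc : ℕ) (arity : Fin np → ℕ) (k : ℕ) →
    Σ (List (CSF np nc arity)) λ L →
      All (λ G → ConnCard≤ G k) L ×
      ((F : CSF np nc arity) → ConnCard≤ F k → Any (λ G → F ≋ G) L)
lemma2 np nc arity k = representatives , All.tabulate connCard , normalise
  where
    open Blocks {np} {nc} {arity} k
    connCard : ∀ {G} → G ∈ representatives → ConnCard≤ G k
    connCard G∈ with _ , T∈ , refl ← ∈-map⁻ assemble G∈ = assemble-connCard T∈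
    normalise : (F : CSF np nc arity) → ConnCard≤ F k → Any (λ G → F ≋ G) representatives
    normalise F connCard = lose normalForm∈representatives equivalence
      where open Normalise k F connCard
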